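{- Let $n,k\ge1$ and $A=(l,\mathbf a,\mathbf m,\mathbf b)\in\mathcal A'(n,k)$. Let $c_1<c_2<\dots<c_s$ be the distinct values of $\mathbf a$. Then for every $r\in\{1,\dots,s\}$ and every $i$ with $a_i=c_r$, we have $m_i\le (r-1)k$ (i.e., every $m$-number in row $r$ of $T(A)$ is at most $(r-1)k$).
   Context: Fix integers $n,k\ge1$. For $\mathbf m\in\mathbb Z_{\ge0}^n$, $\mathbf b\in\mathbb Z_{\ge1}^n$ and distinct $i,j$, let $d_k^{i,j}(\mathbf m,\mathbf b)=k+m_j-m_i+\delta(b_i>b_j)$ if $m_i>m_j$, and $k-1+m_i-m_j+\delta(b_i<b_j)$ if $m_i\le m_j$ ($\delta$ = $0/1$ indicator). Order triples by $(a,m,b)\prec(a',m',b')$ iff $a<a'$, or $a=a'$ and $m>m'$, or $a=a'$, $m=m'$, $b<b'$. $\mathcal A(n,k)$ is the set of $(l,\mathbf a,\mathbf m,\mathbf b)$ with $l\in\{0,\dots,n\}$, $\mathbf a,\mathbf b\in\mathbb Z_{\ge1}^n$, $\mathbf m\in\mathbb Z_{\ge0}^n$ such that: (i) the triples $(a_i,m_i,b_i)$ are $\prec$-increasing for $l+1\le i\le n$ and $\prec$-decreasing for $1\le i\le l$; (ii) $m_i>0$ for $i\le l$; (iii) for $i<j$, if $m_j-k+1\le m_i\le m_j+k$ then $b_i\ne b_j$. $\sigma_i$ is the rank of $(a_i,m_i,b_i)$ among all $n$ (distinct) triples in order $\prec$. $\mathrm{move}_i(A)$: change $l$ to $l-1$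 if $i\le l$, to $l+1$ if $i>l$, removing the $i$-th triple and reinserting it into the block on the other side of the dividing position at the unique place making (i) hold. $i$ is $k$-movable if $\mathrm{move}_i(A)\in\mathcal A(n,k)$ and for all $j$ with $\sigma_j<\sigma_i$: $d_k^{i,j}(\mathbf m,\mathbf b)\le0$ and $d_k^{j,i}(\mathbf m,\mathbf b)\le0$. $\mathcal A'(n,k)$ is the set of $A\in\mathcal A(n,k)$ with no $k$-movable index (the fixed points of the map $\iota_k$ that moves the $k$-movable index of smallest $\sigma$-value). $T(A)$ is the diagram whose $r$-th row consists of the pairs $(m_i,b_i)$ for those $i$ with $a_i=c_r$; the "$m$-numbers in row $r$" are these $m_i$. -}

module Defs where

open import Data.Nat using (ℕ; zero; suc; _+_; _*_; _∸_; _≤_; _<_; _<?_; _<ᵇ_)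
import Data.Nat as N
open import Data.Nat.Properties using (_≟_)
open import Data.Integer as Z using (ℤ; +_; _-_)
open import Data.Fin using (Fin; toℕ)
open import Data.List using (List; []; _∷_; _++_; length; lookup; removeAt; take; drop; filter; allFin)
import Data.List as L
open import Data.Product using (_×_; _,_; Σ; ∃)
open import Data.Sum using (_⊎_)
open import Data.Bool using (Bool; true; false; if_then_else_)
open import Relation.Nullary using (Dec; yes; no; ¬_)
open import Relation.Nullary.Decidable using (_×-dec_; _⊎-dec_)
open import Relation.Binary.PropositionalEquality using (_≡_; _≢_)

Triple : Set
Triple = ℕ × ℕ × ℕ

tA tM tB : Triple → ℕ
tA (a , m , b) = a
tM (a , m , b) = m
tB (a , m , b) = b

_≺_ : Triple → Triple → Set
(a , m , b) ≺ (a' , m' , b') =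
  a < a' ⊎ ((a ≡ a' × m' < m) ⊎ (a ≡ a' × m ≡ m' × b < b'))

_≺?_ : (t u : Triple) → Dec (t ≺ u)
(a , m , b) ≺? (a' , m' , b') =
  (a <? a') ⊎-dec (((a ≟ a') ×-dec (m' <? m)) ⊎-dec ((a ≟ a') ×-dec ((m ≟ m') ×-dec (b <? b'))))

insertInc : Triple → List Triple → List Triple
insertInc t [] = t ∷ []
insertInc t (u ∷ us) with t ≺? u
... | yes _ = t ∷ u ∷ us
... | no  _ = u ∷ insertInc t us

insertDec : Triple → List Triple → List Triple
insertDec t [] = t ∷ []
insertDec t (u ∷ us) with u ≺? t
... | yes _ = t ∷ u ∷ us
... | no  _ = u ∷ insertDec t us

-- An element A = (l, a, m, b) is represented as l together with the list of
-- the n triples (a_i, m_i, b_i); index i (1-based in the paper) is Fin entry i-1.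
record Config : Set where
  constructor cfg
  field
    ell : ℕ
    ts  : List Triple
open Config public

Idx : Config → Set
Idx A = Fin (length (ts A))

aOf mOf bOf : (A : Config) → Idx A → ℕ
aOf A i = tA (lookup (ts A) i)
mOf A i = tM (lookup (ts A) i)
bOf A i = tB (lookup (ts A) i)

InA : ℕ → ℕ → Config → Set
InA n k A =
  length (ts A) ≡ n × ell A ≤ n
  × (∀ i → 1 ≤ aOf A i × 1 ≤ bOf A i)
  × (∀ (i j : Idx A) → toℕ i < toℕ j → ell A ≤ toℕ i →
        lookup (ts A) i ≺ lookup (ts A) j)
  × (∀ (i j : Idx A) → toℕ i < toℕ j → toℕ j < ell A →
        lookup (ts A) j ≺ lookup (ts A) i)
  × (∀ (i : Idx A) → toℕ i < ell A → 0 < mOf A i)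
  × (∀ (i j : Idx A) → toℕ i < toℕ j →
        mOf A j + 1 ≤ mOf A i + k → mOf A i ≤ mOf A j + k →
        bOf A i ≢ bOf A j)

move : (A : Config) → Idx A → Config
move A i with toℕ i <? ell A
... | yes _ = cfg (ell A ∸ 1)
                  (take (ell A ∸ 1) rest ++ insertInc t (drop (ell A ∸ 1) rest))
  where t = lookup (ts A) i
        rest = removeAt (ts A) i
... | no  _ = cfg (suc (ell A))
                  (insertDec t (take (ell A) rest) ++ drop (ell A) rest)
  where t = lookup (ts A) i
        rest = removeAt (ts A) i

σ : (A : Config) → Idx A → ℕ
σ A i = suc (length (filter (λ j → lookup (ts A) j ≺? lookup (ts A) i) (allFin (length (ts A)))))

δ : Bool → ℤ
δ true  = + 1
δ false = + 0

d : ℕ → (A : Config) → Idx A → Idx A → ℤ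
d k A i j =
  if mOf A j <ᵇ mOf A i
  then (+ k) Z.+ (+ mOf A j) - (+ mOf A i) Z.+ δ (bOf A j <ᵇ bOf A i)
  else (+ k) - (+ 1) Z.+ (+ mOf A i) - (+ mOf A j) Z.+ δ (bOf A i <ᵇ bOf A j)

kMovable : ℕ → ℕ → (A : Config) → Idx A → Set
kMovable n k A i =
  InA n k (move A i)
  × (∀ (j : Idx A) → σ A j < σ A i → (d k A i j Z.≤ + 0) × (d k A j i Z.≤ + 0))

InA' : ℕ → ℕ → Config → Set
InA' n k A = InA n k A × (∀ (i : Idx A) → ¬ kMovable n k A i)

-- Induction along σ. Suppose the triple t at index i, in row r, had mᵢ > (r-1)k. A triple below t
-- in the same row has m-number ≥ mᵢ, contradicting the induction hypothesis, so every triple below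
-- t lies in an earlier row and its m-number is at most (r-2)k < mᵢ - k. Then all the d-values of i
-- against smaller triples are ≤ 0, and move_i(A) ∈ 𝒜(n,k): moving t across the dividing position
-- only swaps it with triples far below it, for which condition (iii) is vacuous. So i would be
-- k-movable, contradicting A ∈ 𝒜'(n,k).

module Submission where

open import Defs
open import Level using (0ℓ)
open import Function using (_∘_)
open import Data.Nat using (ℕ; zero; suc; _+_; _*_; _∸_; _≤_; _<_; z≤n; s≤s; z<s; _<ᵇ_)
open import Data.Nat.Properties
open import Data.Nat.Induction using (<-wellFounded)
open import Data.Integer as ℤ using (+_; _-_)
import Data.Integer.Properties as ℤ
open import Data.Integer.Tactic.RingSolver using (solve-∀)
open import Data.Fin using (Fin; toℕ) renaming (zero to fzero; suc to fsuc)
open import Data.Fin.Properties using (toℕ-injective)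
open import Data.Bool using (true; false)
open import Data.Product using (∃; ∃₂; _×_; _,_; proj₁; proj₂)
open import Data.Sum using (inj₁; inj₂)
open import Data.List using (List; []; _∷_; _++_; length; lookup; take; drop; removeAt; filter; allFin)
open import Data.List.Properties using (length-take; length-++-≤ˡ; length-++-sucʳ; ++-assoc; take++drop≡id)
open import Data.List.Membership.Propositional using (_∈_)
open import Data.List.Membership.Propositional.Properties using (∈-allFin; ∈-lookup)
open import Data.List.Relation.Unary.Any using (here; there)
open import Data.List.Relation.Unary.All as All using (All; []; _∷_)
open import Data.List.Relation.Unary.All.Properties using (++⁺; ++⁻ˡ; ++⁻ʳ)
open import Data.List.Relation.Unary.AllPairs using (AllPairs; []; _∷_)
open import Data.List.Relation.Binary.Permutation.Propositional using (_↭_; ↭-sym)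
open import Data.List.Relation.Binary.Permutation.Propositional.Properties
  using (↭-length; ++⁺ˡ; shift; All-resp-↭)
open import Relation.Nullary using (¬_; yes; no; contradiction)
open import Relation.Unary using (Pred; Decidable; _⊆_)
open import Relation.Binary using (Trichotomous; Tri; tri<; tri≈; tri>)
open import Relation.Binary.PropositionalEquality
import Induction.WellFounded as WF
import Relation.Binary.Construct.On as On

≺-trans : ∀ {x y z} → x ≺ y → y ≺ z → x ≺ z
≺-trans {_ , _ , _} {_ , _ , _} {_ , _ , _} (inj₁ p) (inj₁ q) = inj₁ (<-trans p q)
≺-trans {_ , _ , _} {_ , _ , _} {_ , _ , _} (inj₁ p) (inj₂ (inj₁ (refl , _))) = inj₁ p
≺-trans {_ , _ , _} {_ , _ , _} {_ , _ , _} (inj₁ p) (inj₂ (inj₂ (refl , _))) = inj₁ p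
≺-trans {_ , _ , _} {_ , _ , _} {_ , _ , _} (inj₂ (inj₁ (refl , _))) (inj₁ q) = inj₁ q
≺-trans {_ , _ , _} {_ , _ , _} {_ , _ , _} (inj₂ (inj₂ (refl , _))) (inj₁ q) = inj₁ q
≺-trans {_ , _ , _} {_ , _ , _} {_ , _ , _} (inj₂ (inj₁ (refl , p))) (inj₂ (inj₁ (refl , q))) =
  inj₂ (inj₁ (refl , <-trans q p))
≺-trans {_ , _ , _} {_ , _ , _} {_ , _ , _} (inj₂ (inj₁ (refl , p))) (inj₂ (inj₂ (refl , refl , _))) =
  inj₂ (inj₁ (refl , p))
≺-trans {_ , _ , _} {_ , _ , _} {_ , _ , _} (inj₂ (inj₂ (refl , refl , _))) (inj₂ (inj₁ (refl , q))) =
  inj₂ (inj₁ (refl , q))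
≺-trans {_ , _ , _} {_ , _ , _} {_ , _ , _} (inj₂ (inj₂ (refl , refl , p))) (inj₂ (inj₂ (refl , refl , q))) =
  inj₂ (inj₂ (refl , refl , <-trans p q))

≺-irrefl : ∀ {x} → ¬ x ≺ x
≺-irrefl {_ , _ , _} (inj₁ p) = <-irrefl refl p
≺-irrefl {_ , _ , _} (inj₂ (inj₁ (_ , p))) = <-irrefl refl p
≺-irrefl {_ , _ , _} (inj₂ (inj₂ (_ , _ , p))) = <-irrefl refl p

≺-asym : ∀ {x y} → x ≺ y → ¬ y ≺ x
≺-asym x≺y y≺x = ≺-irrefl (≺-trans x≺y y≺x)

_≻_ : Triple → Triple → Set
x ≻ y = y ≺ x

tri-≺ : ∀ {x y} → x ≺ y → Tri (x ≺ y) (x ≡ y) (y ≺ x)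
tri-≺ x≺y = tri< x≺y (λ { refl → ≺-irrefl x≺y }) (≺-asym x≺y)

tri-≻ : ∀ {x y} → y ≺ x → Tri (x ≺ y) (x ≡ y) (y ≺ x)
tri-≻ y≺x = tri> (≺-asym y≺x) (λ { refl → ≺-irrefl y≺x }) y≺x

≺-compare : Trichotomous _≡_ _≺_
≺-compare (a , m , b) (a′ , m′ , b′) with <-cmp a a′
... | tri< a<a′ _ _ = tri-≺ (inj₁ a<a′)
... | tri> _ _ a′<a = tri-≻ (inj₁ a′<a)
... | tri≈ _ refl _ with <-cmp m′ m
...   | tri< m′<m _ _ = tri-≺ (inj₂ (inj₁ (refl , m′<m)))
...   | tri> _ _ m<m′ = tri-≻ (inj₂ (inj₁ (refl , m<m′)))
...   | tri≈ _ refl _ with <-cmp b b′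
...     | tri< b<b′ _ _ = tri-≺ (inj₂ (inj₂ (refl , refl , b<b′)))
...     | tri> _ _ b′<b = tri-≻ (inj₂ (inj₂ (refl , refl , b′<b)))
...     | tri≈ _ refl _ = tri≈ ≺-irrefl refl ≺-irrefl


module _ {X : Set} {P Q : Pred X 0ℓ} (P? : Decidable P) (Q? : Decidable Q) (P⊆Q : P ⊆ Q) where

  length-filter-mono : ∀ xs → length (filter P? xs) ≤ length (filter Q? xs)
  length-filter-mono [] = z≤n
  length-filter-mono (x ∷ xs) with P? x | Q? x
  ... | yes _  | yes _  = s≤s (length-filter-mono xs)
  ... | yes px | no ¬qx = contradiction (P⊆Q px) ¬qx
  ... | no _   | yes _  = m≤n⇒m≤1+n (length-filter-mono xs)
  ... | no _   | no _   = length-filter-mono xs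

  length-filter-mono-< : ∀ {xs y} → y ∈ xs → Q y → ¬ P y →
                         length (filter P? xs) < length (filter Q? xs)
  length-filter-mono-< {x ∷ xs} (here refl) qx ¬px with P? x | Q? x
  ... | yes px | _      = contradiction px ¬px
  ... | no _   | yes _  = s≤s (length-filter-mono xs)
  ... | no _   | no ¬qx = contradiction qx ¬qx
  length-filter-mono-< {x ∷ xs} (there y∈xs) qy ¬py with P? x | Q? x
  ... | yes _  | yes _  = s≤s (length-filter-mono-< y∈xs qy ¬py)
  ... | yes px | no ¬qx = contradiction (P⊆Q px) ¬qx
  ... | no _   | yes _  = m≤n⇒m≤1+n (length-filter-mono-< y∈xs qy ¬py)
  ... | no _   | no _   = length-filter-mono-< y∈xs qy ¬py

-- σ A i is rank A (lookup (ts A) i) by definition, so σ depends only on the triple at i.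
rank : Config → Triple → ℕ
rank A t = suc (length (filter (λ j → lookup (ts A) j ≺? t) (allFin (length (ts A)))))

σ-mono : ∀ A (i j : Idx A) → lookup (ts A) i ≺ lookup (ts A) j → σ A i < σ A j
σ-mono A i j tᵢ≺tⱼ = s≤s (length-filter-mono-< (λ x → lookup (ts A) x ≺? lookup (ts A) i)
  (λ x → lookup (ts A) x ≺? lookup (ts A) j) (λ x≺tᵢ → ≺-trans x≺tᵢ tᵢ≺tⱼ)
  (∈-allFin i) tᵢ≺tⱼ ≺-irrefl)

σ<⇒≺ : ∀ A (i j : Idx A) → σ A j < σ A i → lookup (ts A) j ≺ lookup (ts A) i
σ<⇒≺ A i j σⱼ<σᵢ with ≺-compare (lookup (ts A) j) (lookup (ts A) i)
... | tri< tⱼ≺tᵢ _ _ = tⱼ≺tᵢ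
... | tri≈ _ tⱼ≡tᵢ _ = contradiction σⱼ<σᵢ (<-irrefl (cong (rank A) tⱼ≡tᵢ))
... | tri> _ _ tᵢ≺tⱼ = contradiction σⱼ<σᵢ (<-asym (σ-mono A i j tᵢ≺tⱼ))

δ≤1 : ∀ b → δ b ℤ.≤ + 1
δ≤1 true  = ℤ.≤-refl
δ≤1 false = ℤ.+≤+ z≤n

[i-j]+1≡[i+1]-j : ∀ i j → (i - j) ℤ.+ + 1 ≡ (i ℤ.+ + 1) - j
[i-j]+1≡[i+1]-j = solve-∀

[x-y]+δ≤0 : ∀ {x y} b → x + 1 ≤ y → (+ x - + y) ℤ.+ δ b ℤ.≤ + 0
[x-y]+δ≤0 {x} {y} b x+1≤y = begin
  (+ x - + y) ℤ.+ δ b  ≤⟨ ℤ.+-monoʳ-≤ (+ x - + y) (δ≤1 b) ⟩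
  (+ x - + y) ℤ.+ + 1  ≡⟨ [i-j]+1≡[i+1]-j (+ x) (+ y) ⟩
  + x ℤ.+ + 1 - + y    ≤⟨ ℤ.i≤j⇒i-j≤0 (ℤ.+≤+ x+1≤y) ⟩
  + 0                  ∎
  where open ℤ.≤-Reasoning

far⇒dᵢⱼ≤0 : ∀ k A (i j : Idx A) → mOf A j + k < mOf A i → d k A i j ℤ.≤ + 0
far⇒dᵢⱼ≤0 k A i j mⱼ+k<mᵢ
  with mOf A j <ᵇ mOf A i | <⇒<ᵇ (≤-<-trans (m≤m+n (mOf A j) k) mⱼ+k<mᵢ)
... | true  | _ = [x-y]+δ≤0 _ (≤-trans (≤-reflexive k+mⱼ+1≡mⱼ+k+1) mⱼ+k<mᵢ)
  where k+mⱼ+1≡mⱼ+k+1 = trans (+-comm (k + mOf A j) 1) (cong suc (+-comm k (mOf A j)))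

far⇒dⱼᵢ≤0 : ∀ k → 1 ≤ k → ∀ A (i j : Idx A) → mOf A j + k < mOf A i → d k A j i ℤ.≤ + 0
far⇒dⱼᵢ≤0 (suc k) _ A i j mⱼ+k<mᵢ with mOf A i <ᵇ mOf A j | <ᵇ⇒< (mOf A i) (mOf A j)
... | true  | mᵢ<mⱼ = contradiction (mᵢ<mⱼ _) (<-asym (≤-<-trans (m≤m+n (mOf A j) (suc k)) mⱼ+k<mᵢ))
... | false | _     = [x-y]+δ≤0 _ (≤-trans (≤-reflexive k+mⱼ+1≡mⱼ+[1+k]) (<⇒≤ mⱼ+k<mᵢ))
  where
  k+mⱼ+1≡mⱼ+[1+k] : k + mOf A j + 1 ≡ mOf A j + suc k
  k+mⱼ+1≡mⱼ+[1+k] =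
    trans (+-comm (k + mOf A j) 1) (trans (cong suc (+-comm k (mOf A j))) (sym (+-suc (mOf A j) k)))

module _ {A : Set} where

  lookup⇒All : ∀ {P : A → Set} (xs : List A) → (∀ i → P (lookup xs i)) → All P xs
  lookup⇒All []       f = []
  lookup⇒All (x ∷ xs) f = f fzero ∷ lookup⇒All xs (f ∘ fsuc)

  All-take⇒lookup : ∀ {P : A → Set} l (xs : List A) → All P (take l xs) →
                    ∀ i → toℕ i < l → P (lookup xs i)
  All-take⇒lookup (suc l) (x ∷ xs) (px ∷ _)   fzero    _         = px
  All-take⇒lookup (suc l) (x ∷ xs) (_ ∷ pxs)  (fsuc i) (s≤s i<l) = All-take⇒lookup l xs pxs i i<l

  lookup⇒All-take : ∀ {P : A → Set} l (xs : List A) →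
                    (∀ i → toℕ i < l → P (lookup xs i)) → All P (take l xs)
  lookup⇒All-take zero    xs       f = []
  lookup⇒All-take (suc l) []       f = []
  lookup⇒All-take (suc l) (x ∷ xs) f = f fzero z<s ∷ lookup⇒All-take l xs (λ i i<l → f (fsuc i) (s≤s i<l))

  AllPairs-drop⇒lookup : ∀ {R : A → A → Set} l (xs : List A) → AllPairs R (drop l xs) →
                         ∀ i j → toℕ i < toℕ j → l ≤ toℕ i → R (lookup xs i) (lookup xs j)
  AllPairs-drop⇒lookup zero (x ∷ xs) (px ∷ _) fzero (fsuc j) _ _ = All.lookup px (∈-lookup j)
  AllPairs-drop⇒lookup zero (x ∷ xs) (_ ∷ pxs) (fsuc i) (fsuc j) (s≤s i<j) _ =
    AllPairs-drop⇒lookup zero xs pxs i j i<j z≤n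
  AllPairs-drop⇒lookup (suc l) (x ∷ xs) pxs (fsuc i) (fsuc j) (s≤s i<j) (s≤s l≤i) =
    AllPairs-drop⇒lookup l xs pxs i j i<j l≤i

  lookup⇒AllPairs-drop : ∀ {R : A → A → Set} l (xs : List A) →
                         (∀ i j → toℕ i < toℕ j → l ≤ toℕ i → R (lookup xs i) (lookup xs j)) →
                         AllPairs R (drop l xs)
  lookup⇒AllPairs-drop zero    []       f = []
  lookup⇒AllPairs-drop zero    (x ∷ xs) f =
    lookup⇒All xs (λ j → f fzero (fsuc j) z<s z≤n)
    ∷ lookup⇒AllPairs-drop zero xs (λ i j i<j _ → f (fsuc i) (fsuc j) (s≤s i<j) z≤n)
  lookup⇒AllPairs-drop (suc l) []       f = []
  lookup⇒AllPairs-drop (suc l) (x ∷ xs) f =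
    lookup⇒AllPairs-drop l xs (λ i j i<j l≤i → f (fsuc i) (fsuc j) (s≤s i<j) (s≤s l≤i))

  AllPairs-take⇒lookup : ∀ {R : A → A → Set} l (xs : List A) → AllPairs R (take l xs) →
                         ∀ i j → toℕ i < toℕ j → toℕ j < l → R (lookup xs i) (lookup xs j)
  AllPairs-take⇒lookup (suc l) (x ∷ xs) (px ∷ _) fzero (fsuc j) _ (s≤s j<l) =
    All-take⇒lookup l xs px j j<l
  AllPairs-take⇒lookup (suc l) (x ∷ xs) (_ ∷ pxs) (fsuc i) (fsuc j) (s≤s i<j) (s≤s j<l) =
    AllPairs-take⇒lookup l xs pxs i j i<j j<l

  lookup⇒AllPairs-take : ∀ {R : A → A → Set} l (xs : List A) →
                         (∀ i j → toℕ i < toℕ j → toℕ j < l → R (lookup xs i) (lookup xs j)) →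
                         AllPairs R (take l xs)
  lookup⇒AllPairs-take zero    xs       f = []
  lookup⇒AllPairs-take (suc l) []       f = []
  lookup⇒AllPairs-take (suc l) (x ∷ xs) f =
    lookup⇒All-take l xs (λ j j<l → f fzero (fsuc j) z<s (s≤s j<l))
    ∷ lookup⇒AllPairs-take l xs (λ i j i<j j<l → f (fsuc i) (fsuc j) (s≤s i<j) (s≤s j<l))

  length-take-≤ : ∀ l (xs : List A) → l ≤ length xs → length (take l xs) ≡ l
  length-take-≤ l xs l≤len = trans (length-take l xs) (m≤n⇒m⊓n≡m l≤len)

  take-length-++ : ∀ (xs ys : List A) → take (length xs) (xs ++ ys) ≡ xs
  take-length-++ []       ys = refl
  take-length-++ (x ∷ xs) ys = cong (x ∷_) (take-length-++ xs ys)

  drop-length-++ : ∀ (xs ys : List A) → drop (length xs) (xs ++ ys) ≡ ys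
  drop-length-++ []       ys = refl
  drop-length-++ (x ∷ xs) ys = drop-length-++ xs ys

module _ {A : Set} where

  ++-regroup : ∀ (D₁ D₂ I₁ I₂ : List A) → (D₁ ++ D₂) ++ I₁ ++ I₂ ≡ D₁ ++ (D₂ ++ I₁) ++ I₂
  ++-regroup D₁ D₂ I₁ I₂ = trans (++-assoc D₁ D₂ (I₁ ++ I₂)) (cong (D₁ ++_) (sym (++-assoc D₂ I₁ I₂)))

  All-middle : ∀ {P : A → Set} D₁ D₂ I₁ I₂ → All P ((D₁ ++ D₂) ++ I₁ ++ I₂) → All P (D₂ ++ I₁)
  All-middle D₁ D₂ I₁ I₂ p = ++⁻ˡ (D₂ ++ I₁) (++⁻ʳ D₁ (subst (All _) (++-regroup D₁ D₂ I₁ I₂) p))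

  ↭-moveʳ : ∀ X B {x : A} {C} → X ++ x ∷ B ++ C ↭ X ++ B ++ x ∷ C
  ↭-moveʳ X B {x} {C} = ++⁺ˡ X (↭-sym (shift x B C))

  ↭-cross : ∀ D₁ D₂ I₁ I₂ {x : A} → (D₁ ++ D₂) ++ I₁ ++ x ∷ I₂ ↭ (D₁ ++ x ∷ D₂) ++ I₁ ++ I₂
  ↭-cross D₁ D₂ I₁ I₂ {x} =
    subst₂ _↭_ (sym (++-regroup D₁ D₂ I₁ (x ∷ I₂))) (sym (++-regroup D₁ (x ∷ D₂) I₁ I₂))
    (↭-sym (↭-moveʳ D₁ (D₂ ++ I₁)))

  All-remove : ∀ {P : A → Set} X {x Y} → All P (X ++ x ∷ Y) → All P (X ++ Y)
  All-remove X {x} {Y} p = All.tail (All-resp-↭ (shift x X Y) p)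

  All-insert : ∀ {P : A → Set} X {x Y} → P x → All P (X ++ Y) → All P (X ++ x ∷ Y)
  All-insert X {x} {Y} px p = All-resp-↭ (↭-sym (shift x X Y)) (px ∷ p)

module _ {A : Set} {R : A → A → Set} where

  AllPairs-following : ∀ X {x : A} {Y} → AllPairs R (X ++ x ∷ Y) → All (R x) Y
  AllPairs-following []      (px ∷ _) = px
  AllPairs-following (_ ∷ X) (_ ∷ p)  = AllPairs-following X p

  AllPairs-preceding : ∀ X {x : A} {Y} → AllPairs R (X ++ x ∷ Y) → All (λ y → R y x) X
  AllPairs-preceding []      _        = []
  AllPairs-preceding (_ ∷ X) (py ∷ p) = All.head (++⁻ʳ X py) ∷ AllPairs-preceding X p

  AllPairs-remove : ∀ X {x : A} {Y} → AllPairs R (X ++ x ∷ Y) → AllPairs R (X ++ Y)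
  AllPairs-remove []      (_ ∷ p)  = p
  AllPairs-remove (_ ∷ X) (py ∷ p) = All-remove X py ∷ AllPairs-remove X p

  AllPairs-insert : ∀ X {x : A} {Y} → AllPairs R (X ++ Y) → All (λ y → R y x) X → All (R x) Y →
                    AllPairs R (X ++ x ∷ Y)
  AllPairs-insert []      p        []          Rx = Rx ∷ p
  AllPairs-insert (_ ∷ X) (py ∷ p) (Ryx ∷ RXx) Rx = All-insert X Ryx py ∷ AllPairs-insert X p RXx Rx

  AllPairs-moveʳ : ∀ X B {x : A} {C} → AllPairs R (X ++ x ∷ B ++ C) → All (λ y → R y x) B →
                   AllPairs R (X ++ B ++ x ∷ C)
  AllPairs-moveʳ []      []      p                  _            = p
  AllPairs-moveʳ []      (_ ∷ B) (px ∷ pb ∷ p) (Rbx ∷ RBx) =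
    All-insert B Rbx pb ∷ AllPairs-moveʳ [] B (All.tail px ∷ p) RBx
  AllPairs-moveʳ (_ ∷ X) B (py ∷ p) RBx = All-resp-↭ (↭-moveʳ X B) py ∷ AllPairs-moveʳ X B p RBx

  AllPairs-moveˡ : ∀ X B {x : A} {C} → AllPairs R (X ++ B ++ x ∷ C) → All (R x) B →
                   AllPairs R (X ++ x ∷ B ++ C)
  AllPairs-moveˡ []      []      p          _            = p
  AllPairs-moveˡ []      (_ ∷ B) (pb ∷ p) (Rxb ∷ RxB) with AllPairs-moveˡ [] B p RxB
  ... | px ∷ p′ = (Rxb ∷ px) ∷ All-remove B pb ∷ p′
  AllPairs-moveˡ (_ ∷ X) B (py ∷ p) RxB = All-resp-↭ (↭-sym (↭-moveʳ X B)) py ∷ AllPairs-moveˡ X B p RxB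

  AllPairs-crossʳ : ∀ D₁ D₂ I₁ I₂ {x : A} → AllPairs R ((D₁ ++ x ∷ D₂) ++ I₁ ++ I₂) →
                    All (λ y → R y x) (D₂ ++ I₁) → AllPairs R ((D₁ ++ D₂) ++ I₁ ++ x ∷ I₂)
  AllPairs-crossʳ D₁ D₂ I₁ I₂ {x} p RBx = subst (AllPairs R) (sym (++-regroup D₁ D₂ I₁ (x ∷ I₂)))
    (AllPairs-moveʳ D₁ (D₂ ++ I₁) (subst (AllPairs R) (++-regroup D₁ (x ∷ D₂) I₁ I₂) p) RBx)

  AllPairs-crossˡ : ∀ D₁ D₂ I₁ I₂ {x : A} → AllPairs R ((D₁ ++ D₂) ++ I₁ ++ x ∷ I₂) →
                    All (R x) (D₂ ++ I₁) → AllPairs R ((D₁ ++ x ∷ D₂) ++ I₁ ++ I₂)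
  AllPairs-crossˡ D₁ D₂ I₁ I₂ {x} p RxB = subst (AllPairs R) (sym (++-regroup D₁ (x ∷ D₂) I₁ I₂))
    (AllPairs-moveˡ D₁ (D₂ ++ I₁) (subst (AllPairs R) (++-regroup D₁ D₂ I₁ (x ∷ I₂)) p) RxB)

module _ {A : Set} where

  removeAt-split : (xs : List A) (i : Fin (length xs)) →
    ∃₂ λ I₁ I₂ → xs ≡ I₁ ++ lookup xs i ∷ I₂ × removeAt xs i ≡ I₁ ++ I₂
  removeAt-split (x ∷ xs) fzero    = [] , xs , refl , refl
  removeAt-split (x ∷ xs) (fsuc i) with removeAt-split xs i
  ... | I₁ , I₂ , xs≡ , removed≡ = x ∷ I₁ , I₂ , cong (x ∷_) xs≡ , cong (x ∷_) removed≡

  removeAt-split-take : (xs : List A) (l : ℕ) (i : Fin (length xs)) → toℕ i < l →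
    ∃₂ λ D₁ D₂ → take l xs ≡ D₁ ++ lookup xs i ∷ D₂
      × take (l ∸ 1) (removeAt xs i) ≡ D₁ ++ D₂
      × drop (l ∸ 1) (removeAt xs i) ≡ drop l xs
  removeAt-split-take (x ∷ xs) (suc l)       fzero    _             = [] , take l xs , refl , refl , refl
  removeAt-split-take (x ∷ xs) (suc (suc l)) (fsuc i) (s≤s i<1+l) with removeAt-split-take xs (suc l) i i<1+l
  ... | D₁ , D₂ , taken≡ , taken′≡ , dropped′≡ =
    x ∷ D₁ , D₂ , cong (x ∷_) taken≡ , cong (x ∷_) taken′≡ , dropped′≡

  removeAt-split-drop : (xs : List A) (l : ℕ) (i : Fin (length xs)) → l ≤ toℕ i →
    ∃₂ λ I₁ I₂ → drop l xs ≡ I₁ ++ lookup xs i ∷ I₂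
      × take l (removeAt xs i) ≡ take l xs
      × drop l (removeAt xs i) ≡ I₁ ++ I₂
  removeAt-split-drop xs zero i _ with removeAt-split xs i
  ... | I₁ , I₂ , xs≡ , removed≡ = I₁ , I₂ , xs≡ , refl , removed≡
  removeAt-split-drop (x ∷ xs) (suc l) (fsuc i) (s≤s l≤i) with removeAt-split-drop xs l i l≤i
  ... | I₁ , I₂ , dropped≡ , taken′≡ , dropped′≡ =
    I₁ , I₂ , dropped≡ , cong (x ∷_) taken′≡ , dropped′≡

insertInc-split : ∀ t I → AllPairs _≺_ I → All (t ≢_) I →
  ∃₂ λ I₁ I₂ → I ≡ I₁ ++ I₂ × insertInc t I ≡ I₁ ++ t ∷ I₂ × All (_≺ t) I₁ × All (t ≺_) I₂
insertInc-split t []       _          _          = [] , [] , refl , refl , [] , []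
insertInc-split t (u ∷ us) (u≺us ∷ us↑) (t≢u ∷ t∉us) with t ≺? u
... | yes t≺u = [] , u ∷ us , refl , refl , [] , t≺u ∷ All.map (≺-trans t≺u) u≺us
... | no t⊀u with ≺-compare u t | insertInc-split t us us↑ t∉us
...   | tri< u≺t _ _   | I₁ , I₂ , us≡ , ins≡ , I₁≺t , t≺I₂ =
          u ∷ I₁ , I₂ , cong (u ∷_) us≡ , cong (u ∷_) ins≡ , u≺t ∷ I₁≺t , t≺I₂
...   | tri≈ _ u≡t _   | _ = contradiction (sym u≡t) t≢u
...   | tri> _ _ t≺u   | _ = contradiction t≺u t⊀u

insertDec-split : ∀ t D → AllPairs _≻_ D → All (_≢ t) D →
  ∃₂ λ D₁ D₂ → D ≡ D₁ ++ D₂ × insertDec t D ≡ D₁ ++ t ∷ D₂ × All (t ≺_) D₁ × All (_≺ t) D₂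
insertDec-split t []       _          _          = [] , [] , refl , refl , [] , []
insertDec-split t (u ∷ us) (u≻us ∷ us↓) (u≢t ∷ us∌t) with u ≺? t
... | yes u≺t = [] , u ∷ us , refl , refl , [] , u≺t ∷ All.map (λ v≺u → ≺-trans v≺u u≺t) u≻us
... | no u⊀t with ≺-compare u t | insertDec-split t us us↓ us∌t
...   | tri> _ _ t≺u   | D₁ , D₂ , us≡ , ins≡ , t≺D₁ , D₂≺t =
          u ∷ D₁ , D₂ , cong (u ∷_) us≡ , cong (u ∷_) ins≡ , t≺u ∷ t≺D₁ , D₂≺t
...   | tri≈ _ u≡t _   | _ = contradiction u≡t u≢t
...   | tri< u≺t _ _   | _ = contradiction u≺t u⊀t

length-insertDec : ∀ t xs → length (insertDec t xs) ≡ suc (length xs)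
length-insertDec t []       = refl
length-insertDec t (u ∷ us) with u ≺? t
... | yes _ = refl
... | no  _ = cong suc (length-insertDec t us)

Labelled Positive : Triple → Set
Labelled t = 1 ≤ tA t × 1 ≤ tB t
Positive t = 0 < tM t

-- Condition (iii) of 𝒜(n,k) for a pair of triples, the first one standing to the left.
Separated : ℕ → Triple → Triple → Set
Separated k x y = tM y + 1 ≤ tM x + k → tM x ≤ tM y + k → tB x ≢ tB y

separated⇒≢ : ∀ {k} → 1 ≤ k → ∀ {x y} → Separated k x y → x ≢ y
separated⇒≢ {k} k≥1 {x} sep refl = sep (+-monoʳ-≤ (tM x) k≥1) (m≤m+n (tM x) k) refl

FarAbove : ℕ → Triple → List Triple → Set
FarAbove k t = All (λ y → y ≺ t → tM y + k < tM t)

far⇒separated : ∀ {k t ys} → FarAbove k t ys → All (_≺ t) ys →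
                All (λ y → Separated k y t × Separated k t y) ys
far⇒separated far below = All.map both (All.zip (far , below))
  where
  both : ∀ {k t y} → (y ≺ t → tM y + k < tM t) × y ≺ t → Separated k y t × Separated k t y
  both (far , y≺t) =
      (λ tooClose _ → contradiction (≤-<-trans (m≤m+n _ 1) (≤-<-trans tooClose (far y≺t))) (n≮n _))
    , (λ _ tooClose → contradiction (far y≺t) (≤⇒≯ tooClose))

record Arranged (n k : ℕ) (X Y : List Triple) : Set where
  field
    length≡    : length (X ++ Y) ≡ n
    labelled   : All Labelled (X ++ Y)
    X-desc     : AllPairs _≻_ X
    Y-asc      : AllPairs _≺_ Y
    X-positive : All Positive X
    separated  : AllPairs (Separated k) (X ++ Y)

l≤length : ∀ {n k l ts} → InA n k (cfg l ts) → l ≤ length ts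
l≤length (length≡ , l≤n , _) = subst (_ ≤_) (sym length≡) l≤n

Arranged⇒InA : ∀ {n k X Y l} → Arranged n k X Y → length X ≡ l → InA n k (cfg l (X ++ Y))
Arranged⇒InA {X = X} {Y} a refl =
  length≡ , subst (length X ≤_) length≡ (length-++-≤ˡ X) , (λ i → All.lookup labelled (∈-lookup i))
  , AllPairs-drop⇒lookup (length X) (X ++ Y) (subst (AllPairs _≺_) (sym (drop-length-++ X Y)) Y-asc)
  , AllPairs-take⇒lookup (length X) (X ++ Y) (subst (AllPairs _≻_) (sym (take-length-++ X Y)) X-desc)
  , All-take⇒lookup (length X) (X ++ Y) (subst (All Positive) (sym (take-length-++ X Y)) X-positive)
  , λ i j i<j → AllPairs-drop⇒lookup zero (X ++ Y) separated i j i<j z≤n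
  where open Arranged a

InA⇒Arranged : ∀ {n k l ts} → InA n k (cfg l ts) → Arranged n k (take l ts) (drop l ts)
InA⇒Arranged {l = l} {ts} (length≡ , _ , labelled , asc , desc , positive , separated) = record
  { length≡    = subst (λ ts → length ts ≡ _) (sym (take++drop≡id l ts)) length≡
  ; labelled   = subst (All Labelled) (sym (take++drop≡id l ts)) (lookup⇒All ts labelled)
  ; X-desc     = lookup⇒AllPairs-take l ts desc
  ; Y-asc      = lookup⇒AllPairs-drop l ts asc
  ; X-positive = lookup⇒All-take l ts positive
  ; separated  = subst (AllPairs _) (sym (take++drop≡id l ts))
                   (lookup⇒AllPairs-drop zero ts (λ i j i<j _ → separated i j i<j))
  }

Arranged-distinctʳ : ∀ {n k} → 1 ≤ k → ∀ D₁ D₂ {t Y} → Arranged n k (D₁ ++ t ∷ D₂) Y →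
                     All (t ≢_) Y
Arranged-distinctʳ k≥1 D₁ D₂ {t} {Y} a = All.map (separated⇒≢ k≥1)
  (++⁻ʳ D₂ (AllPairs-following D₁ (subst (AllPairs _) (++-assoc D₁ (t ∷ D₂) Y) (Arranged.separated a))))

Arranged-distinctˡ : ∀ {n k} → 1 ≤ k → ∀ I₁ I₂ {t X} → Arranged n k X (I₁ ++ t ∷ I₂) →
                     All (_≢ t) X
Arranged-distinctˡ k≥1 I₁ I₂ {t} {X} a = All.map (separated⇒≢ k≥1)
  (++⁻ˡ X (AllPairs-preceding (X ++ I₁)
    (subst (AllPairs _) (sym (++-assoc X I₁ (t ∷ I₂))) (Arranged.separated a))))

-- Moving t across the dividing position only changes its order relative to D₂ ++ I₁, all of
-- whose elements lie below t.
arranged-moveʳ : ∀ {n k} → 1 ≤ k → ∀ D₁ D₂ {t Y} → Arranged n k (D₁ ++ t ∷ D₂) Y →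
                 FarAbove k t ((D₁ ++ t ∷ D₂) ++ Y) → Arranged n k (D₁ ++ D₂) (insertInc t Y)
arranged-moveʳ k≥1 D₁ D₂ {t} {Y} a far
  with insertInc-split t Y (Arranged.Y-asc a) (Arranged-distinctʳ k≥1 D₁ D₂ a)
... | I₁ , I₂ , refl , inserted≡ , I₁≺t , t≺I₂ rewrite inserted≡ = record
  { length≡    = trans (↭-length (↭-cross D₁ D₂ I₁ I₂)) length≡
  ; labelled   = All-resp-↭ (↭-sym (↭-cross D₁ D₂ I₁ I₂)) labelled
  ; X-desc     = AllPairs-remove D₁ X-desc
  ; Y-asc      = AllPairs-insert I₁ Y-asc I₁≺t t≺I₂
  ; X-positive = All-remove D₁ X-positive
  ; separated  = AllPairs-crossʳ D₁ D₂ I₁ I₂ separated (All.map proj₁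
                   (far⇒separated (All.tail (All-middle D₁ (t ∷ D₂) I₁ I₂ far))
                                  (++⁺ (AllPairs-following D₁ X-desc) I₁≺t)))
  }
  where open Arranged a

arranged-moveˡ : ∀ {n k} → 1 ≤ k → ∀ I₁ I₂ {t X} → Arranged n k X (I₁ ++ t ∷ I₂) → Positive t →
                 FarAbove k t (X ++ I₁ ++ t ∷ I₂) → Arranged n k (insertDec t X) (I₁ ++ I₂)
arranged-moveˡ k≥1 I₁ I₂ {t} {X} a t>0 far
  with insertDec-split t X (Arranged.X-desc a) (Arranged-distinctˡ k≥1 I₁ I₂ a)
... | D₁ , D₂ , refl , inserted≡ , t≺D₁ , D₂≺t rewrite inserted≡ = record
  { length≡    = trans (↭-length (↭-sym (↭-cross D₁ D₂ I₁ I₂))) length≡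
  ; labelled   = All-resp-↭ (↭-cross D₁ D₂ I₁ I₂) labelled
  ; X-desc     = AllPairs-insert D₁ X-desc t≺D₁ D₂≺t
  ; Y-asc      = AllPairs-remove I₁ Y-asc
  ; X-positive = All-insert D₁ t>0 X-positive
  ; separated  = AllPairs-crossˡ D₁ D₂ I₁ I₂ separated (All.map proj₂
                   (far⇒separated (All-middle D₁ D₂ I₁ (t ∷ I₂) far)
                                  (++⁺ D₂≺t (AllPairs-preceding I₁ Y-asc))))
  }
  where open Arranged a

module _ {n k : ℕ} (k≥1 : 1 ≤ k) {l : ℕ} {ts : List Triple} (inA : InA n k (cfg l ts))
         (i : Fin (length ts)) where

  private
    t = lookup ts i
    rest = removeAt ts i

  InA-move-rightwards : FarAbove k t ts → toℕ i < l →
    InA n k (cfg (l ∸ 1) (take (l ∸ 1) rest ++ insertInc t (drop (l ∸ 1) rest)))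
  InA-move-rightwards far i<l with removeAt-split-take ts l i i<l
  ... | D₁ , D₂ , taken≡ , taken′≡ , dropped′≡ rewrite taken′≡ | dropped′≡ =
    Arranged⇒InA
      (arranged-moveʳ k≥1 D₁ D₂ (subst (λ X → Arranged n k X _) taken≡ (InA⇒Arranged {ts = ts} inA))
                                 (subst (FarAbove k t) ts≡ far))
      length≡
    where
    ts≡ : ts ≡ (D₁ ++ t ∷ D₂) ++ drop l ts
    ts≡ = trans (sym (take++drop≡id l ts)) (cong (_++ drop l ts) taken≡)
    length≡ : length (D₁ ++ D₂) ≡ l ∸ 1
    length≡ = cong (_∸ 1) (begin
      suc (length (D₁ ++ D₂))  ≡⟨ length-++-sucʳ D₁ t D₂ ⟨
      length (D₁ ++ t ∷ D₂)    ≡⟨ cong length taken≡ ⟨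
      length (take l ts)       ≡⟨ length-take-≤ l ts (l≤length {ts = ts} inA) ⟩
      l                        ∎)
      where open ≡-Reasoning

  InA-move-leftwards : Positive t → FarAbove k t ts → l ≤ toℕ i →
    InA n k (cfg (suc l) (insertDec t (take l rest) ++ drop l rest))
  InA-move-leftwards t>0 far l≤i with removeAt-split-drop ts l i l≤i
  ... | I₁ , I₂ , dropped≡ , taken′≡ , dropped′≡ rewrite taken′≡ | dropped′≡ =
    Arranged⇒InA
      (arranged-moveˡ k≥1 I₁ I₂ (subst (Arranged n k _) dropped≡ (InA⇒Arranged {ts = ts} inA)) t>0
                                 (subst (FarAbove k t) ts≡ far))
      length≡
    where
    ts≡ : ts ≡ take l ts ++ I₁ ++ t ∷ I₂
    ts≡ = trans (sym (take++drop≡id l ts)) (cong (take l ts ++_) dropped≡)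
    length≡ : length (insertDec t (take l ts)) ≡ suc l
    length≡ = trans (length-insertDec t (take l ts)) (cong suc (length-take-≤ l ts (l≤length {ts = ts} inA)))

move-preserves-InA : ∀ {n k} → 1 ≤ k → (A : Config) → InA n k A → (i : Idx A) →
                     Positive (lookup (ts A) i) → FarAbove k (lookup (ts A) i) (ts A) →
                     InA n k (move A i)
move-preserves-InA k≥1 (cfg l ts) inA i t>0 far with toℕ i <? l
... | yes i<l = InA-move-rightwards k≥1 inA i far i<l
... | no  i≮l = InA-move-leftwards k≥1 inA i t>0 far (≮⇒≥ i≮l)

far⇒kMovable : ∀ {n k} → 1 ≤ k → (A : Config) → InA n k A → (i : Idx A) → 0 < mOf A i →
               (∀ j → lookup (ts A) j ≺ lookup (ts A) i → mOf A j + k < mOf A i) →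
               kMovable n k A i
far⇒kMovable k≥1 A inA i mᵢ>0 far =
  move-preserves-InA k≥1 A inA i mᵢ>0 (lookup⇒All (ts A) far)
  , λ j σⱼ<σᵢ → let mⱼ+k<mᵢ = far j (σ<⇒≺ A i j σⱼ<σᵢ) in
      far⇒dᵢⱼ≤0 _ A i j mⱼ+k<mᵢ , far⇒dⱼᵢ≤0 _ k≥1 A i j mⱼ+k<mᵢ

m≤row*k : ∀ {n k} → 1 ≤ k → (A : Config) → InA' n k A → (row : Idx A → ℕ) →
          (∀ i j → aOf A j < aOf A i → row j < row i) →
          (∀ i j → aOf A j ≡ aOf A i → row j ≡ row i) →
          ∀ i → mOf A i ≤ row i * k
m≤row*k {k = k} k≥1 A (inA , immovable) row row-mono row-resp =
  wfRec (λ i → mOf A i ≤ row i * k) bound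
  where
  open WF.All (On.wellFounded (σ A) <-wellFounded) 0ℓ using (wfRec)
  bound : ∀ i → (∀ {j} → σ A j < σ A i → mOf A j ≤ row j * k) → mOf A i ≤ row i * k
  bound i ih with mOf A i ≤? row i * k
  ... | yes mᵢ≤row*k = mᵢ≤row*k
  ... | no  mᵢ≰row*k = contradiction (far⇒kMovable k≥1 A inA i (≤-<-trans z≤n row*k<mᵢ) far) (immovable i)
    where
    row*k<mᵢ = ≰⇒> mᵢ≰row*k
    sameRow⇒m< : ∀ {j} → mOf A j ≤ row j * k → aOf A j ≡ aOf A i → mOf A j < mOf A i
    sameRow⇒m< {j} mⱼ≤row*k aⱼ≡aᵢ =
      ≤-<-trans (subst (λ r → mOf A j ≤ r * k) (row-resp i j aⱼ≡aᵢ) mⱼ≤row*k) row*k<mᵢ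
    far : ∀ j → lookup (ts A) j ≺ lookup (ts A) i → mOf A j + k < mOf A i
    far j tⱼ≺tᵢ with ih (σ-mono A j i tⱼ≺tᵢ) | tⱼ≺tᵢ
    ... | mⱼ≤row*k | inj₁ aⱼ<aᵢ = begin-strict
      mOf A j + k      ≤⟨ +-monoˡ-≤ k mⱼ≤row*k ⟩
      row j * k + k    ≡⟨ +-comm (row j * k) k ⟩
      suc (row j) * k  ≤⟨ *-monoˡ-≤ k (row-mono i j aⱼ<aᵢ) ⟩
      row i * k        <⟨ row*k<mᵢ ⟩
      mOf A i          ∎
      where open ≤-Reasoning
    ... | mⱼ≤row*k | inj₂ (inj₁ (aⱼ≡aᵢ , mᵢ<mⱼ)) =
      contradiction mᵢ<mⱼ (<-asym (sameRow⇒m< mⱼ≤row*k aⱼ≡aᵢ))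
    ... | mⱼ≤row*k | inj₂ (inj₂ (aⱼ≡aᵢ , mⱼ≡mᵢ , _)) =
      contradiction mⱼ≡mᵢ (<⇒≢ (sameRow⇒m< mⱼ≤row*k aⱼ≡aᵢ))

module _ {s} {c : Fin s → ℕ} (c-mono : ∀ r r′ → toℕ r < toℕ r′ → c r < c r′) where

  strictMono⇒reflects-< : ∀ r r′ → c r < c r′ → toℕ r < toℕ r′
  strictMono⇒reflects-< r r′ cr<cr′ with <-cmp (toℕ r) (toℕ r′)
  ... | tri< r<r′ _ _ = r<r′
  ... | tri≈ _ r≡r′ _ = contradiction (cong c (toℕ-injective r≡r′)) (<⇒≢ cr<cr′)
  ... | tri> _ _ r′<r = contradiction cr<cr′ (<-asym (c-mono r′ r r′<r))

  strictMono⇒injective : ∀ r r′ → c r ≡ c r′ → toℕ r ≡ toℕ r′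
  strictMono⇒injective r r′ cr≡cr′ with <-cmp (toℕ r) (toℕ r′)
  ... | tri< r<r′ _ _ = contradiction cr≡cr′ (<⇒≢ (c-mono r r′ r<r′))
  ... | tri≈ _ r≡r′ _ = r≡r′
  ... | tri> _ _ r′<r = contradiction (sym cr≡cr′) (<⇒≢ (c-mono r′ r r′<r))

lemma4p13 : (n k : ℕ) → 1 ≤ n → 1 ≤ k → (A : Config) → InA' n k A →
    (s : ℕ) (c : Fin s → ℕ) →
    (∀ (r r' : Fin s) → toℕ r < toℕ r' → c r < c r') →
    (∀ (r : Fin s) → ∃ λ (j : Idx A) → aOf A j ≡ c r) →
    (∀ (j : Idx A) → ∃ λ (r : Fin s) → aOf A j ≡ c r) →
    ∀ (r : Fin s) (i : Idx A) → aOf A i ≡ c r → mOf A i ≤ toℕ r * k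
lemma4p13 n k _ k≥1 A A∈𝒜′ s c c-mono _ rowOf r i aᵢ≡cᵣ =
  subst (λ r′ → mOf A i ≤ r′ * k) rowᵢ≡r (m≤row*k k≥1 A A∈𝒜′ row row-mono row-resp i)
  where
  row : Idx A → ℕ
  row j = toℕ (proj₁ (rowOf j))
  a≡c-row : ∀ j → aOf A j ≡ c (proj₁ (rowOf j))
  a≡c-row j = proj₂ (rowOf j)
  row-mono : ∀ i j → aOf A j < aOf A i → row j < row i
  row-mono i j aⱼ<aᵢ = strictMono⇒reflects-< c-mono _ _ (subst₂ _<_ (a≡c-row j) (a≡c-row i) aⱼ<aᵢ)
  row-resp : ∀ i j → aOf A j ≡ aOf A i → row j ≡ row i
  row-resp i j aⱼ≡aᵢ =
    strictMono⇒injective c-mono _ _ (trans (sym (a≡c-row j)) (trans aⱼ≡aᵢ (a≡c-row i)))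
  rowᵢ≡r : row i ≡ toℕ r
  rowᵢ≡r = strictMono⇒injective c-mono _ _ (trans (sym (a≡c-row i)) aᵢ≡cᵣ)
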